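{- Let $s$ and $t$ be integers such that $t$ is even and $2\le s<t$. Let $D=\{\pm1,\pm2,\ldots,\pm\frac{s-1}{2}\}$ if $s$ is odd, and $D=\{\pm1,\pm2,\ldots,\pm(\frac s2-1)\}\cup\{\frac t2\}$ if $s$ is even. Then $\overrightarrow{\mathrm{Circ}}(t;D)$ admits a $\vec C_2$-factorization.
   Context: For $S\subseteq\mathbb{Z}_t\setminus\{0\}$, the directed circulant $\overrightarrow{\mathrm{Circ}}(t;S)$ has vertex set $\{u_i:i\in\mathbb{Z}_t\}$ and arcs $(u_i,u_{i+d})$ for $i\in\mathbb{Z}_t$, $d\in S$. A $\vec C_2$-factorization is a partition of the arc set into spanning subdigraphs each consisting of $t/2$ vertex-disjoint directed 2-cycles (a directed 2-cycle being a pair of opposite arcs between two vertices). -}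

module Defs where

open import Data.Bool using (Bool; true; false)
open import Data.Nat as ℕ using (ℕ; zero; suc; NonZero; _∸_)
open import Data.Nat.DivMod using (_%_; _/_)
open import Data.Integer as ℤ using (ℤ; +_; -_; _%ℕ_)
open import Data.Fin using (Fin; toℕ)
open import Data.List using (List; []; _∷_; _++_; concatMap; map; upTo)
open import Data.Bool.ListAction using (any)
open import Data.Product using (Σ; Σ-syntax; _×_)
open import Relation.Binary.PropositionalEquality using (_≡_)
open import Relation.Nullary.Decidable using (⌊_⌋)

oneTo : ℕ → List ℕ
oneTo m = map suc (upTo m)

pm : ℕ → List ℤ
pm m = concatMap (λ i → (+ i) ∷ (- (+ i)) ∷ []) (oneTo m)

-- The connection set D of the statement (as integers, to be read modulo t):
--   s odd  : D = {±1, ..., ±(s-1)/2}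
--   s even : D = {±1, ..., ±(s/2 - 1)} ∪ {t/2}
-- (for odd s, (s-1)/2 = s / 2 with floor division)
connD : ℕ → ℕ → List ℤ
connD s t with s % 2
... | zero  = pm ((s / 2) ∸ 1) ++ ((+ (t / 2)) ∷ [])
... | suc _ = pm (s / 2)

-- Arc relation of the directed circulant Circ(t;S) on vertex set Z_t = Fin t,
-- with S given by a list of integers (read modulo t):
-- (u_i , u_j) is an arc iff j ≡ i + d (mod t) for some d ∈ S.
isArc : (t : ℕ) .{{_ : NonZero t}} → List ℤ → Fin t → Fin t → Bool
isArc t S u v = any (λ d → ⌊ ((+ toℕ u) ℤ.+ d) %ℕ t ℕ.≟ toℕ v ⌋) S

Arc : (t : ℕ) .{{_ : NonZero t}} → List ℤ → Fin t → Fin t → Set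
Arc t S u v = isArc t S u v ≡ true

-- A directed-2-cycle factor (C2-factor) given as a set of arcs (a predicate F on arcs):
-- every vertex has exactly one outgoing arc in F, and F is closed under
-- reversing arcs (so the arcs of F pair up into directed 2-cycles covering
-- every vertex exactly once, i.e. t/2 vertex-disjoint directed 2-cycles).
-- A C2-factorization is a colouring of the arcs with k colours such that each
-- colour class is such a factor (the colour classes partition the arc set).
record C2Factorization (t : ℕ) .{{_ : NonZero t}} (S : List ℤ) : Set where
  field
    k      : ℕ
    colour : (u v : Fin t) → Arc t S u v → Fin k
    reverse : (u v : Fin t) (a : Arc t S u v) →
              Σ[ a' ∈ Arc t S v u ] colour v u a' ≡ colour u v a
    outArc : (c : Fin k) (u : Fin t) →
             Σ[ v ∈ Fin t ] Σ[ a ∈ Arc t S u v ] (colour u v a ≡ c ×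
               ((v' : Fin t) (a' : Arc t S u v') → colour u v' a' ≡ c → v' ≡ v))

-- Since D = -D, a C2-factorization of Circ(t; D) is a 1-factorization of the undirected circulant:
-- one involution u ↦ partner c u per colour c, the partners of each vertex running through its
-- neighbours exactly once. Such factorizations add up over disjoint arc sets, so it suffices to
-- factorize the pieces. The diameter u ↦ u + t/2 is a single matching. As t is even, the arcs of an
-- odd length a split into two matchings by the parity of their tail. Two consecutive lengths a (odd)
-- and d (even) give four matchings: one length-a matching is set aside, and the other together with
-- the arcs of length d forms prisms C × K₂ over the cycles of u ↦ u + d. These are 3-edge-coloured
-- from a proper 3-colouring of the cycles of u ↦ u + d (each rung gets the colour missing at its
-- ends). Finally the lengths 1, …, m are covered by such pairs, starting from ∅ or {1}.

module Submission where

open import Defs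
open import Data.Nat using (ℕ; NonZero; _≤_; _<_)
open import Data.Nat.Divisibility using (_∣_)

open import Data.Bool using (Bool; true; false; not; _xor_; if_then_else_)
open import Data.Bool.Properties using (T-≡; not-involutive; not-distribʳ-xor; xor-inverseˡ; xor-same)
open import Data.Empty using (⊥; ⊥-elim)
open import Data.Fin using (Fin; toℕ; fromℕ<; splitAt; join)
open import Data.Fin.Patterns using (0F; 1F; 2F)
open import Data.Fin.Properties using (_≟_; all?; toℕ-fromℕ<; toℕ-injective; toℕ<n; splitAt-join; join-splitAt)
open import Data.Integer as ℤ using (ℤ; +_; -_; _%ℕ_)
open import Data.Integer.Properties using (m-n≡m⊖n; +-cancelˡ-⊖; ⊖-≥; ⊖-<)
open import Data.List using (List; []; _∷_; _++_)
open import Data.List.Membership.Propositional using (find; lose)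
open import Data.List.Membership.Propositional.Properties using (∈-upTo⁺; ∈-upTo⁻)
open import Data.List.Relation.Unary.Any as Any using (Any; here; there)
open import Data.List.Relation.Unary.Any.Properties
  using (any⁺; any⁻; map⁺; map⁻; concatMap⁺; concatMap⁻; ++⁺ˡ; ++⁺ʳ; ++⁻)
open import Data.Nat using (zero; suc; z<s; z≤n; s≤s; >-nonZero⁻¹; _+_; _∸_; _%_; _/_; _≡ᵇ_; _≤?_)
open import Data.Nat.DivMod
open import Data.Nat.Properties hiding (_≟_)
open import Data.Product using (Σ-syntax; _×_; _,_; proj₁; proj₂)
open import Data.Sum using (_⊎_; inj₁; inj₂; [_,_]′)
import Data.Sum as Sum
open import Function using (_∘_; _⇔_; mk⇔; Equivalence)
open import Function.Properties.Equivalence using () renaming (sym to ⇔-sym)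
open import Level using (0ℓ)
open import Relation.Binary.Core using (Rel)
open import Relation.Binary.PropositionalEquality
open import Relation.Nullary using (yes; no; ¬?; _×-dec_; _→-dec_)
open import Relation.Nullary.Decidable using (from-yes; toWitness; fromWitness)

record OneFactorization {t : ℕ} (E : Rel (Fin t) 0ℓ) : Set where
  field
    k                  : ℕ
    partner            : Fin k → Fin t → Fin t
    partner-adjacent   : ∀ c u → E u (partner c u)
    partner-involutive : ∀ c u → partner c (partner c u) ≡ u
    colourOf           : ∀ {u v} → E u v → Fin k
    partner-colourOf   : ∀ {u v} (e : E u v) → partner (colourOf e) u ≡ v
    partner-injective  : ∀ u {c c′} → partner c u ≡ partner c′ u → c ≡ c′

module _ {t : ℕ} where

  involutionFactorization : (σ : Fin t → Fin t) → (∀ u → σ (σ u) ≡ u) →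
                            OneFactorization (λ u v → v ≡ σ u)
  involutionFactorization σ σ-involutive = record
    { k                  = 1
    ; partner            = λ _ → σ
    ; partner-adjacent   = λ _ _ → refl
    ; partner-involutive = λ _ → σ-involutive
    ; colourOf           = λ _ → 0F
    ; partner-colourOf   = sym
    ; partner-injective  = λ { _ {0F} {0F} _ → refl }
    }

  emptyFactorization : OneFactorization {t} (λ _ _ → ⊥)
  emptyFactorization = record
    { k                  = 0
    ; partner            = λ ()
    ; partner-adjacent   = λ ()
    ; partner-involutive = λ ()
    ; colourOf           = λ ()
    ; partner-colourOf   = λ ()
    ; partner-injective  = λ { _ {()} }
    }

  transfer : {E E′ : Rel (Fin t) 0ℓ} → (∀ {u v} → E u v ⇔ E′ u v) →
             OneFactorization E → OneFactorization E′
  transfer E⇔E′ F = record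
    { k                  = k
    ; partner            = partner
    ; partner-adjacent   = λ c u → Equivalence.to E⇔E′ (partner-adjacent c u)
    ; partner-involutive = partner-involutive
    ; colourOf           = λ e → colourOf (Equivalence.from E⇔E′ e)
    ; partner-colourOf   = λ e → partner-colourOf (Equivalence.from E⇔E′ e)
    ; partner-injective  = partner-injective
    }
    where open OneFactorization F

  union : {E₁ E₂ : Rel (Fin t) 0ℓ} → OneFactorization E₁ → OneFactorization E₂ →
          (∀ {u v} → E₁ u v → E₂ u v → ⊥) → OneFactorization (λ u v → E₁ u v ⊎ E₂ u v)
  union {E₁} {E₂} F₁ F₂ disjoint = record
    { k                  = F₁.k + F₂.k
    ; partner            = λ c → partner⊎ (splitAt F₁.k c)
    ; partner-adjacent   = λ c → adjacent⊎ (splitAt F₁.k c)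
    ; partner-involutive = λ c → involutive⊎ (splitAt F₁.k c)
    ; colourOf           = λ e → join F₁.k F₂.k (colourOf⊎ e)
    ; partner-colourOf   = λ {u} e →
        trans (cong (λ c → partner⊎ c u) (splitAt-join F₁.k F₂.k (colourOf⊎ e))) (colourOf⊎-partner e)
    ; partner-injective  = λ u {c} {c′} eq →
        trans (sym (join-splitAt F₁.k F₂.k c))
              (trans (cong (join F₁.k F₂.k) (injective⊎ u {splitAt F₁.k c} {splitAt F₁.k c′} eq))
                     (join-splitAt F₁.k F₂.k c′))
    }
    where
    module F₁ = OneFactorization F₁
    module F₂ = OneFactorization F₂

    partner⊎ : Fin F₁.k ⊎ Fin F₂.k → Fin t → Fin t
    partner⊎ = [ F₁.partner , F₂.partner ]′

    adjacent⊎ : ∀ c u → E₁ u (partner⊎ c u) ⊎ E₂ u (partner⊎ c u)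
    adjacent⊎ (inj₁ c) u = inj₁ (F₁.partner-adjacent c u)
    adjacent⊎ (inj₂ c) u = inj₂ (F₂.partner-adjacent c u)

    involutive⊎ : ∀ c u → partner⊎ c (partner⊎ c u) ≡ u
    involutive⊎ (inj₁ c) = F₁.partner-involutive c
    involutive⊎ (inj₂ c) = F₂.partner-involutive c

    colourOf⊎ : ∀ {u v} → E₁ u v ⊎ E₂ u v → Fin F₁.k ⊎ Fin F₂.k
    colourOf⊎ = Sum.map F₁.colourOf F₂.colourOf

    colourOf⊎-partner : ∀ {u v} (e : E₁ u v ⊎ E₂ u v) → partner⊎ (colourOf⊎ e) u ≡ v
    colourOf⊎-partner (inj₁ e) = F₁.partner-colourOf e
    colourOf⊎-partner (inj₂ e) = F₂.partner-colourOf e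

    injective⊎ : ∀ u {c c′} → partner⊎ c u ≡ partner⊎ c′ u → c ≡ c′
    injective⊎ u {inj₁ c} {inj₁ c′} eq = cong inj₁ (F₁.partner-injective u eq)
    injective⊎ u {inj₂ c} {inj₂ c′} eq = cong inj₂ (F₂.partner-injective u eq)
    injective⊎ u {inj₁ c} {inj₂ c′} eq =
      ⊥-elim (disjoint (F₁.partner-adjacent c u) (subst (E₂ u) (sym eq) (F₂.partner-adjacent c′ u)))
    injective⊎ u {inj₂ c} {inj₁ c′} eq =
      ⊥-elim (disjoint (F₁.partner-adjacent c′ u) (subst (E₂ u) eq (F₂.partner-adjacent c u)))

toC2Factorization : ∀ {t} .{{_ : NonZero t}} {S} → OneFactorization (Arc t S) → C2Factorization t S
toC2Factorization {t} {{_}} {S} F = record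
  { k       = k
  ; colour  = λ _ _ → colourOf
  ; reverse = reverse
  ; outArc  = λ c u → partner c u , partner-adjacent c u ,
                      partner-injective u (partner-colourOf (partner-adjacent c u)) ,
                      λ v a eq → trans (sym (partner-colourOf a)) (cong (λ c′ → partner c′ u) eq)
  }
  where
  open OneFactorization F

  reverse : (u v : Fin t) (a : Arc t S u v) → Σ[ a′ ∈ Arc t S v u ] colourOf a′ ≡ colourOf a
  reverse u v a = a′ , partner-injective v (trans (partner-colourOf a′) (sym back))
    where
    back : partner (colourOf a) v ≡ u
    back = trans (cong (partner (colourOf a)) (sym (partner-colourOf a))) (partner-involutive _ u)
    a′ : Arc t S v u
    a′ = subst (Arc t S v) back (partner-adjacent (colourOf a) v)

[m%n+o]%n≡[m+o]%n : ∀ m o n .{{_ : NonZero n}} → (m % n + o) % n ≡ (m + o) % n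
[m%n+o]%n≡[m+o]%n m o n = begin
  (m % n + o) % n         ≡⟨ %-distribˡ-+ (m % n) o n ⟩
  (m % n % n + o % n) % n ≡⟨ cong (λ x → (x + o % n) % n) (m%n%n≡m%n m n) ⟩
  (m % n + o % n) % n     ≡⟨ %-distribˡ-+ m o n ⟨
  (m + o) % n             ∎
  where open ≡-Reasoning

m+n<o⇒m<o : ∀ m {n o} → m + n < o → m < o
m+n<o⇒m<o m = m+n≤o⇒m≤o (suc m)

m+n<o⇒n<o : ∀ m {n o} → m + n < o → n < o
m+n<o⇒n<o m {n} = ≤-<-trans (m≤n+m n m)

m%2≡1⇒0<m : ∀ {m} → m % 2 ≡ 1 → 0 < m
m%2≡1⇒0<m {suc _} _ = z<s

m%2-cases : ∀ m → m % 2 ≡ 0 ⊎ m % 2 ≡ 1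
m%2-cases m with m % 2 | m%n<n m 2
... | zero        | _ = inj₁ refl
... | suc zero    | _ = inj₂ refl
... | suc (suc _) | s≤s (s≤s ())

m%2≡0⇒[1+m]%2≡1 : ∀ {m} → m % 2 ≡ 0 → suc m % 2 ≡ 1
m%2≡0⇒[1+m]%2≡1 {m} eq = trans (%-distribˡ-+ 1 m 2) (cong (λ r → (1 + r) % 2) eq)

m%2≡1⇒[1+m]%2≡0 : ∀ {m} → m % 2 ≡ 1 → suc m % 2 ≡ 0
m%2≡1⇒[1+m]%2≡0 {m} eq = trans (%-distribˡ-+ 1 m 2) (cong (λ r → (1 + r) % 2) eq)

stripe : ℕ → Fin 3
stripe zero             = 0F
stripe (suc zero)       = 1F
stripe (suc (suc q))    = stripe q

stripe-suc : ∀ q → stripe (suc q) ≢ stripe q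
stripe-suc zero          ()
stripe-suc (suc zero)    ()
stripe-suc (suc (suc q)) = stripe-suc q

stripe≢2 : ∀ q → stripe q ≢ 2F
stripe≢2 zero          ()
stripe≢2 (suc zero)    ()
stripe≢2 (suc (suc q)) = stripe≢2 q

third : Fin 3 → Fin 3 → Fin 3
third 0F 1F = 2F
third 1F 0F = 2F
third 0F 2F = 1F
third 2F 0F = 1F
third _  _  = 0F

third-avoids : ∀ x y → x ≢ y → third x y ≢ x × third x y ≢ y
third-avoids = from-yes (all? λ x → all? λ y → ¬? (x ≟ y) →-dec (¬? (third x y ≟ x) ×-dec ¬? (third x y ≟ y)))

third-unique : ∀ x y c → x ≢ y → c ≢ x → c ≢ y → c ≡ third x y
third-unique = from-yes (all? λ x → all? λ y → all? λ c →
  ¬? (x ≟ y) →-dec (¬? (c ≟ x) →-dec (¬? (c ≟ y) →-dec (c ≟ third x y))))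

data Position {A : Set} (c x y : A) : Set where
  at-x      : c ≡ x → Position c x y
  at-y      : c ≢ x → c ≡ y → Position c x y
  elsewhere : c ≢ x → c ≢ y → Position c x y

position : ∀ {n} (c x y : Fin n) → Position c x y
position c x y with c ≟ x | c ≟ y
... | yes c≡x | _       = at-x c≡x
... | no  c≢x | yes c≡y = at-y c≢x c≡y
... | no  c≢x | no  c≢y = elsewhere c≢x c≢y

module Cyclic (t : ℕ) .{{_ : NonZero t}} where

  infixl 6 _⊕_ _⊖_

  _⊕_ : Fin t → ℕ → Fin t
  u ⊕ j = fromℕ< (m%n<n (toℕ u + j) t)

  _⊖_ : Fin t → ℕ → Fin t
  u ⊖ j = u ⊕ (t ∸ j)

  toℕ-⊕ : ∀ u j → toℕ (u ⊕ j) ≡ (toℕ u + j) % t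
  toℕ-⊕ u j = toℕ-fromℕ< _

  ⊕-assoc : ∀ u i j → u ⊕ i ⊕ j ≡ u ⊕ (i + j)
  ⊕-assoc u i j = toℕ-injective (begin
    toℕ (u ⊕ i ⊕ j)          ≡⟨ toℕ-⊕ (u ⊕ i) j ⟩
    (toℕ (u ⊕ i) + j) % t    ≡⟨ cong (λ x → (x + j) % t) (toℕ-⊕ u i) ⟩
    ((toℕ u + i) % t + j) % t ≡⟨ [m%n+o]%n≡[m+o]%n (toℕ u + i) j t ⟩
    (toℕ u + i + j) % t       ≡⟨ cong (_% t) (+-assoc (toℕ u) i j) ⟩
    (toℕ u + (i + j)) % t     ≡⟨ toℕ-⊕ u (i + j) ⟨
    toℕ (u ⊕ (i + j))         ∎)
    where open ≡-Reasoning

  ⊕-comm : ∀ u i j → u ⊕ i ⊕ j ≡ u ⊕ j ⊕ i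
  ⊕-comm u i j = trans (⊕-assoc u i j) (trans (cong (u ⊕_) (+-comm i j)) (sym (⊕-assoc u j i)))

  ⊕-period : ∀ u → u ⊕ t ≡ u
  ⊕-period u = toℕ-injective (trans (toℕ-⊕ u t) (trans ([m+n]%n≡m%n (toℕ u) t) (m<n⇒m%n≡m (toℕ<n u))))

  ⊕-⊖ : ∀ u {j} → j ≤ t → u ⊕ j ⊖ j ≡ u
  ⊕-⊖ u j≤t = trans (⊕-assoc u _ _) (trans (cong (u ⊕_) (m+[n∸m]≡n j≤t)) (⊕-period u))

  ⊖-⊕ : ∀ u {j} → j ≤ t → u ⊖ j ⊕ j ≡ u
  ⊖-⊕ u j≤t = trans (⊕-assoc u _ _) (trans (cong (u ⊕_) (m∸n+n≡m j≤t)) (⊕-period u))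

  ⊕-offset : ∀ u {i} → i < t → toℕ (u ⊕ i ⊖ toℕ u) ≡ i
  ⊕-offset u {i} i<t = begin
    toℕ (u ⊕ i ⊖ toℕ u)                ≡⟨ cong toℕ (⊕-assoc u i _) ⟩
    toℕ (u ⊕ (i + (t ∸ toℕ u)))        ≡⟨ toℕ-⊕ u _ ⟩
    (toℕ u + (i + (t ∸ toℕ u))) % t    ≡⟨ cong (_% t) (+-comm (toℕ u) _) ⟩
    (i + (t ∸ toℕ u) + toℕ u) % t      ≡⟨ cong (_% t) (+-assoc i _ _) ⟩
    (i + ((t ∸ toℕ u) + toℕ u)) % t    ≡⟨ cong (λ x → (i + x) % t) (m∸n+n≡m (<⇒≤ (toℕ<n u))) ⟩
    (i + t) % t                        ≡⟨ [m+n]%n≡m%n i t ⟩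
    i % t                              ≡⟨ m<n⇒m%n≡m i<t ⟩
    i                                  ∎
    where open ≡-Reasoning

  ⊕-cancelˡ : ∀ u {i j} → i < t → j < t → u ⊕ i ≡ u ⊕ j → i ≡ j
  ⊕-cancelˡ u i<t j<t eq =
    trans (sym (⊕-offset u i<t)) (trans (cong (λ v → toℕ (v ⊖ toℕ u)) eq) (⊕-offset u j<t))

  ⊕≢⊖ : ∀ u {i j} → 0 < j → i + j < t → u ⊕ i ≢ u ⊖ j
  ⊕≢⊖ u {i} {j} 0<j i+j<t eq = <⇒≢ i+j<t (begin
    i + j       ≡⟨ cong (_+ j) (⊕-cancelˡ u (m+n<o⇒m<o i i+j<t) (∸-monoʳ-< 0<j (<⇒≤ j<t)) eq) ⟩
    t ∸ j + j   ≡⟨ m∸n+n≡m (<⇒≤ j<t) ⟩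
    t           ∎)
    where
    open ≡-Reasoning
    j<t : j < t
    j<t = m+n<o⇒n<o i i+j<t

  Length : ℕ → Rel (Fin t) 0ℓ
  Length j u v = v ≡ u ⊕ j ⊎ v ≡ u ⊖ j

  Length-unique : ∀ {i j u v} → 0 < i → 0 < j → i + j < t → Length i u v → Length j u v → i ≡ j
  Length-unique {i} {j} {u} 0<i 0<j i+j<t (inj₁ p) (inj₁ q) =
    ⊕-cancelˡ u (m+n<o⇒m<o i i+j<t) (m+n<o⇒n<o i i+j<t) (trans (sym p) q)
  Length-unique {u = u} 0<i 0<j i+j<t (inj₁ p) (inj₂ q) = ⊥-elim (⊕≢⊖ u 0<j i+j<t (trans (sym p) q))
  Length-unique {i} {j} {u} 0<i 0<j i+j<t (inj₂ p) (inj₁ q) =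
    ⊥-elim (⊕≢⊖ u 0<i (subst (_< t) (+-comm i j) i+j<t) (trans (sym q) p))
  Length-unique {i} {j} {u} 0<i 0<j i+j<t (inj₂ p) (inj₂ q) =
    ∸-cancelˡ-≡ (<⇒≤ i<t) (<⇒≤ j<t) (⊕-cancelˡ u (∸-monoʳ-< 0<i (<⇒≤ i<t)) (∸-monoʳ-< 0<j (<⇒≤ j<t)) (trans (sym p) q))
    where
    i<t : i < t
    i<t = m+n<o⇒m<o i i+j<t
    j<t : j < t
    j<t = m+n<o⇒n<o i i+j<t

  Lengths : ℕ → Rel (Fin t) 0ℓ
  Lengths m u v = Σ[ i ∈ ℕ ] i < m × Length (suc i) u v

  module ShiftColouring (d : ℕ) .{{_ : NonZero d}} (d+d≤t : d + d ≤ t) where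

    private
      colourℕ : ℕ → Fin 3
      colourℕ x with t ∸ d ≤? x
      ... | yes _ = 2F
      ... | no  _ = stripe (x / d)

      colourℕ-high : ∀ {x} → t ∸ d ≤ x → colourℕ x ≡ 2F
      colourℕ-high {x} t∸d≤x with t ∸ d ≤? x
      ... | yes _     = refl
      ... | no  t∸d≰x = ⊥-elim (t∸d≰x t∸d≤x)

      colourℕ-low : ∀ {x} → x < t ∸ d → colourℕ x ≡ stripe (x / d)
      colourℕ-low {x} x<t∸d with t ∸ d ≤? x
      ... | yes t∸d≤x = ⊥-elim (<⇒≱ x<t∸d t∸d≤x)
      ... | no  _     = refl

      colourℕ-low≢2 : ∀ {x} → x < t ∸ d → colourℕ x ≢ 2F
      colourℕ-low≢2 {x} x<t∸d = subst (_≢ 2F) (sym (colourℕ-low x<t∸d)) (stripe≢2 (x / d))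

      colourℕ-step : ∀ {x} → x + d < t → colourℕ x ≢ colourℕ (x + d)
      colourℕ-step {x} x+d<t with ≤-<-connex (t ∸ d) (x + d)
      ... | inj₁ t∸d≤x+d = λ eq → colourℕ-low≢2 x<t∸d (trans eq (colourℕ-high t∸d≤x+d))
        where
        x<t∸d : x < t ∸ d
        x<t∸d = m+n≤o⇒m≤o∸n (suc x) x+d<t
      ... | inj₂ x+d<t∸d = λ eq → stripe-suc (x / d) (begin
        stripe (suc (x / d))   ≡⟨ cong stripe [x+d]/d≡1+x/d ⟨
        stripe ((x + d) / d)   ≡⟨ colourℕ-low x+d<t∸d ⟨
        colourℕ (x + d)        ≡⟨ eq ⟨
        colourℕ x              ≡⟨ colourℕ-low (m+n≤o⇒m≤o∸n (suc x) x+d<t) ⟩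
        stripe (x / d)         ∎)
        where
        open ≡-Reasoning
        [x+d]/d≡1+x/d : (x + d) / d ≡ suc (x / d)
        [x+d]/d≡1+x/d = trans (m/n≡1+[m∸n]/n (m≤n+m d x)) (cong (λ y → suc (y / d)) (m+n∸n≡m x d))

      colourℕ-wrap : ∀ {x} → x < t → t ≤ x + d → colourℕ x ≢ colourℕ ((x + d) % t)
      colourℕ-wrap {x} x<t t≤x+d eq = colourℕ-low≢2 wrapped<t∸d (trans (sym eq) (colourℕ-high t∸d≤x))
        where
        t∸d≤x : t ∸ d ≤ x
        t∸d≤x = m≤n+o⇒m∸n≤o t d (subst (t ≤_) (+-comm x d) t≤x+d)
        wrapped<t∸d : (x + d) % t < t ∸ d
        wrapped<t∸d = begin-strict
          (x + d) % t       ≡⟨ m≤n⇒[n∸m]%m≡n%m t≤x+d ⟨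
          (x + d ∸ t) % t   ≤⟨ m%n≤m _ t ⟩
          x + d ∸ t         <⟨ m<n+o⇒m∸n<o (x + d) t (+-monoˡ-< d x<t) ⟩
          d                 ≤⟨ m+n≤o⇒m≤o∸n d d+d≤t ⟩
          t ∸ d             ∎
          where open ≤-Reasoning

    shiftColouring : Fin t → Fin 3
    shiftColouring u = colourℕ (toℕ u)

    shiftColouring-proper : ∀ u → shiftColouring u ≢ shiftColouring (u ⊕ d)
    shiftColouring-proper u rewrite toℕ-⊕ u d with <-≤-connex (toℕ u + d) t
    ... | inj₁ x+d<t = subst (λ y → colourℕ (toℕ u) ≢ colourℕ y) (sym (m<n⇒m%n≡m x+d<t)) (colourℕ-step x+d<t)
    ... | inj₂ t≤x+d = colourℕ-wrap (toℕ<n u) t≤x+d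

  module EvenOrder (t-even : 2 ∣ t) where

    isEven : Fin t → Bool
    isEven u = toℕ u % 2 ≡ᵇ 0

    private
      toℕ-⊕-%2 : ∀ u j → toℕ (u ⊕ j) % 2 ≡ (toℕ u % 2 + j % 2) % 2
      toℕ-⊕-%2 u j =
        trans (cong (_% 2) (toℕ-⊕ u j)) (trans (m∣n⇒o%n%m≡o%m 2 t _ t-even) (%-distribˡ-+ (toℕ u) j 2))

      keep : ∀ {p} → p < 2 → ((p + 0) % 2 ≡ᵇ 0) ≡ (p ≡ᵇ 0)
      keep {zero}        _ = refl
      keep {suc zero}    _ = refl
      keep {suc (suc _)} (s≤s (s≤s ()))

      flip : ∀ {p} → p < 2 → ((p + 1) % 2 ≡ᵇ 0) ≡ not (p ≡ᵇ 0)
      flip {zero}        _ = refl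
      flip {suc zero}    _ = refl
      flip {suc (suc _)} (s≤s (s≤s ()))

    isEven-⊕-even : ∀ u {j} → j % 2 ≡ 0 → isEven (u ⊕ j) ≡ isEven u
    isEven-⊕-even u {j} j-even =
      trans (cong (_≡ᵇ 0) (trans (toℕ-⊕-%2 u j) (cong (λ r → (toℕ u % 2 + r) % 2) j-even)))
            (keep (m%n<n (toℕ u) 2))

    isEven-⊕-odd : ∀ u {j} → j % 2 ≡ 1 → isEven (u ⊕ j) ≡ not (isEven u)
    isEven-⊕-odd u {j} j-odd =
      trans (cong (_≡ᵇ 0) (trans (toℕ-⊕-%2 u j) (cong (λ r → (toℕ u % 2 + r) % 2) j-odd)))
            (flip (m%n<n (toℕ u) 2))

    isEven-⊖-odd : ∀ u {j} → j ≤ t → j % 2 ≡ 1 → isEven (u ⊖ j) ≡ not (isEven u)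
    isEven-⊖-odd u {j} j≤t j-odd = begin
      isEven (u ⊖ j)               ≡⟨ not-involutive _ ⟨
      not (not (isEven (u ⊖ j)))   ≡⟨ cong not (isEven-⊕-odd (u ⊖ j) j-odd) ⟨
      not (isEven (u ⊖ j ⊕ j))     ≡⟨ cong (not ∘ isEven) (⊖-⊕ u j≤t) ⟩
      not (isEven u)               ∎
      where open ≡-Reasoning

    module Zigzag (a : ℕ) (a-odd : a % 2 ≡ 1) (a+a<t : a + a < t) where

      private
        0<a : 0 < a
        0<a = m%2≡1⇒0<m a-odd
        a≤t : a ≤ t
        a≤t = <⇒≤ (m+n<o⇒m<o a a+a<t)

      zigzag : Bool → Fin t → Fin t
      zigzag b u = if b xor isEven u then u ⊕ a else u ⊖ a

      zigzag-forward : ∀ b u → b xor isEven u ≡ true → zigzag b u ≡ u ⊕ a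
      zigzag-forward b u eq = cong (λ x → if x then u ⊕ a else u ⊖ a) eq

      zigzag-backward : ∀ b u → b xor isEven u ≡ false → zigzag b u ≡ u ⊖ a
      zigzag-backward b u eq = cong (λ x → if x then u ⊕ a else u ⊖ a) eq

      zigzag-involutive : ∀ b u → zigzag b (zigzag b u) ≡ u
      zigzag-involutive b u with b xor isEven u in eq
      ... | true  = trans (zigzag-backward b (u ⊕ a) flipped) (⊕-⊖ u a≤t)
        where
        flipped : b xor isEven (u ⊕ a) ≡ false
        flipped = trans (cong (b xor_) (isEven-⊕-odd u a-odd)) (trans (sym (not-distribʳ-xor b _)) (cong not eq))
      ... | false = trans (zigzag-forward b (u ⊖ a) flipped) (⊖-⊕ u a≤t)
        where
        flipped : b xor isEven (u ⊖ a) ≡ true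
        flipped = trans (cong (b xor_) (isEven-⊖-odd u a≤t a-odd)) (trans (sym (not-distribʳ-xor b _)) (cong not eq))

      zigzag-Length : ∀ b u → Length a u (zigzag b u)
      zigzag-Length b u with b xor isEven u
      ... | true  = inj₁ refl
      ... | false = inj₂ refl

      Length-zigzag : ∀ {u v} → Length a u v → Σ[ b ∈ Bool ] v ≡ zigzag b u
      Length-zigzag {u} (inj₁ v≡u⊕a) = not (isEven u) , trans v≡u⊕a (sym (zigzag-forward (not (isEven u)) u (xor-inverseˡ (isEven u))))
      Length-zigzag {u} (inj₂ v≡u⊖a) = isEven u , trans v≡u⊖a (sym (zigzag-backward (isEven u) u (xor-same (isEven u))))

      zigzag-distinct : ∀ u → zigzag false u ≢ zigzag true u
      zigzag-distinct u with isEven u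
      ... | true  = ⊕≢⊖ u 0<a a+a<t
      ... | false = ⊕≢⊖ u 0<a a+a<t ∘ sym

      zigzagFactorization : ∀ b → OneFactorization (λ u v → v ≡ zigzag b u)
      zigzagFactorization b = involutionFactorization (zigzag b) (zigzag-involutive b)

      oddLengthFactorization : OneFactorization (Length a)
      oddLengthFactorization =
        transfer (mk⇔ to from) (union (zigzagFactorization false) (zigzagFactorization true) disjoint)
        where
        disjoint : ∀ {u v} → v ≡ zigzag false u → v ≡ zigzag true u → ⊥
        disjoint {u} p q = zigzag-distinct u (trans (sym p) q)
        to : ∀ {u v} → v ≡ zigzag false u ⊎ v ≡ zigzag true u → Length a u v
        to {u} (inj₁ p) = subst (Length a u) (sym p) (zigzag-Length false u)
        to {u} (inj₂ p) = subst (Length a u) (sym p) (zigzag-Length true u)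
        from : ∀ {u v} → Length a u v → v ≡ zigzag false u ⊎ v ≡ zigzag true u
        from l with Length-zigzag l
        ... | false , p = inj₁ p
        ... | true  , p = inj₂ p

    module Prism (a d : ℕ) .{{_ : NonZero d}} (a-odd : a % 2 ≡ 1) (d-even : d % 2 ≡ 0)
                 (a+a<t : a + a < t) (d+d<t : d + d < t) (a+d<t : a + d < t) where

      open Zigzag a a-odd a+a<t
      open ShiftColouring d (<⇒≤ d+d<t)

      private
        a≤t : a ≤ t
        a≤t = <⇒≤ (m+n<o⇒m<o a a+a<t)
        d≤t : d ≤ t
        d≤t = <⇒≤ (m+n<o⇒m<o d d+d<t)

      Length-a-d-disjoint : ∀ {u v} → Length a u v → Length d u v → ⊥
      Length-a-d-disjoint la ld with Length-unique (m%2≡1⇒0<m a-odd) (>-nonZero⁻¹ d) a+d<t la ld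
      ... | refl with trans (sym a-odd) d-even
      ...   | ()

      rung : Fin t → Fin t
      rung = zigzag false

      -- Even vertices are the top copy, odd ones the bottom copy of the prism whose rungs are the
      -- arcs of rung; base u is the top end of the rung at u.
      base : Fin t → Fin t
      base u = if isEven u then u else u ⊖ a

      base-even : ∀ u → isEven u ≡ true → base u ≡ u
      base-even u eq = cong (λ x → if x then u else u ⊖ a) eq

      base-odd : ∀ u → isEven u ≡ false → base u ≡ u ⊖ a
      base-odd u eq = cong (λ x → if x then u else u ⊖ a) eq

      base-⊕d : ∀ u → base (u ⊕ d) ≡ base u ⊕ d
      base-⊕d u with isEven u in eq
      ... | true  = base-even (u ⊕ d) (trans (isEven-⊕-even u d-even) eq)
      ... | false = trans (base-odd (u ⊕ d) (trans (isEven-⊕-even u d-even) eq)) (⊕-comm u d (t ∸ a))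

      base-⊖d : ∀ u → base (u ⊖ d) ≡ base u ⊖ d
      base-⊖d u = begin
        base (u ⊖ d)             ≡⟨ ⊕-⊖ _ d≤t ⟨
        base (u ⊖ d) ⊕ d ⊖ d     ≡⟨ cong (_⊖ d) (base-⊕d (u ⊖ d)) ⟨
        base (u ⊖ d ⊕ d) ⊖ d     ≡⟨ cong (λ w → base w ⊖ d) (⊖-⊕ u d≤t) ⟩
        base u ⊖ d               ∎
        where open ≡-Reasoning

      base-rung : ∀ u → base (rung u) ≡ base u
      base-rung u with isEven u in eq
      ... | true  = trans (base-odd (u ⊕ a) (trans (isEven-⊕-odd u a-odd) (cong not eq))) (⊕-⊖ u a≤t)
      ... | false = base-even (u ⊖ a) (trans (isEven-⊖-odd u a≤t a-odd) (cong not eq))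

      -- The arcs of length d at the top copy are coloured by shiftColouring, mirrored at the bottom
      -- copy; each rung takes the colour missing at its ends.
      forwardColour backwardColour : Fin t → Fin 3
      forwardColour u  = shiftColouring (base u)
      backwardColour u = shiftColouring (base u ⊖ d)

      forward≢backward : ∀ u → forwardColour u ≢ backwardColour u
      forward≢backward u eq =
        shiftColouring-proper (base u ⊖ d) (trans (sym eq) (cong shiftColouring (sym (⊖-⊕ (base u) d≤t))))

      forwardColour-⊕d : ∀ u → forwardColour (u ⊕ d) ≢ forwardColour u
      forwardColour-⊕d u eq = shiftColouring-proper (base u) (sym (trans (cong shiftColouring (sym (base-⊕d u))) eq))

      backwardColour-⊕d : ∀ u → backwardColour (u ⊕ d) ≡ forwardColour u
      backwardColour-⊕d u = cong shiftColouring (trans (cong (_⊖ d) (base-⊕d u)) (⊕-⊖ (base u) d≤t))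

      forwardColour-⊖d : ∀ u → forwardColour (u ⊖ d) ≡ backwardColour u
      forwardColour-⊖d u = cong shiftColouring (base-⊖d u)

      forwardColour-rung : ∀ u → forwardColour (rung u) ≡ forwardColour u
      forwardColour-rung u = cong shiftColouring (base-rung u)

      backwardColour-rung : ∀ u → backwardColour (rung u) ≡ backwardColour u
      backwardColour-rung u = cong (λ w → shiftColouring (w ⊖ d)) (base-rung u)

      step : ∀ {c x y : Fin 3} → Position c x y → Fin t → Fin t
      step (at-x _)        u = u ⊕ d
      step (at-y _ _)      u = u ⊖ d
      step (elsewhere _ _) u = rung u

      step-at-x : ∀ {c x y} u → c ≡ x → (p : Position c x y) → step p u ≡ u ⊕ d
      step-at-x u _   (at-x _)          = refl
      step-at-x u c≡x (at-y c≢x _)      = ⊥-elim (c≢x c≡x)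
      step-at-x u c≡x (elsewhere c≢x _) = ⊥-elim (c≢x c≡x)

      step-at-y : ∀ {c x y} u → c ≢ x → c ≡ y → (p : Position c x y) → step p u ≡ u ⊖ d
      step-at-y u c≢x _   (at-x c≡x)        = ⊥-elim (c≢x c≡x)
      step-at-y u _   _   (at-y _ _)        = refl
      step-at-y u _   c≡y (elsewhere _ c≢y) = ⊥-elim (c≢y c≡y)

      step-elsewhere : ∀ {c x y} u → c ≢ x → c ≢ y → (p : Position c x y) → step p u ≡ rung u
      step-elsewhere u c≢x _   (at-x c≡x)      = ⊥-elim (c≢x c≡x)
      step-elsewhere u _   c≢y (at-y _ c≡y)    = ⊥-elim (c≢y c≡y)
      step-elsewhere u _   _   (elsewhere _ _) = refl

      PrismArc : Rel (Fin t) 0ℓ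
      PrismArc u v = Length d u v ⊎ v ≡ rung u

      prismPosition : (c : Fin 3) (u : Fin t) → Position c (forwardColour u) (backwardColour u)
      prismPosition c u = position c (forwardColour u) (backwardColour u)

      prismPartner : Fin 3 → Fin t → Fin t
      prismPartner c u = step (prismPosition c u) u

      prismPartner-adjacent : ∀ c u → PrismArc u (prismPartner c u)
      prismPartner-adjacent c u with prismPosition c u
      ... | at-x _        = inj₁ (inj₁ refl)
      ... | at-y _ _      = inj₁ (inj₂ refl)
      ... | elsewhere _ _ = inj₂ refl

      prismPartner-involutive : ∀ c u → prismPartner c (prismPartner c u) ≡ u
      prismPartner-involutive c u = involutive (prismPosition c u)
        where
        involutive : (p : Position c (forwardColour u) (backwardColour u)) → prismPartner c (step p u) ≡ u
        involutive (at-x c≡x) = trans (step-at-y (u ⊕ d) c≢x′ c≡y′ (prismPosition c (u ⊕ d))) (⊕-⊖ u d≤t)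
          where
          c≢x′ : c ≢ forwardColour (u ⊕ d)
          c≢x′ eq = forwardColour-⊕d u (trans (sym eq) c≡x)
          c≡y′ : c ≡ backwardColour (u ⊕ d)
          c≡y′ = trans c≡x (sym (backwardColour-⊕d u))
        involutive (at-y _ c≡y) =
          trans (step-at-x (u ⊖ d) (trans c≡y (sym (forwardColour-⊖d u))) (prismPosition c (u ⊖ d))) (⊖-⊕ u d≤t)
        involutive (elsewhere c≢x c≢y) =
          trans (step-elsewhere (rung u) (λ eq → c≢x (trans eq (forwardColour-rung u)))
                                         (λ eq → c≢y (trans eq (backwardColour-rung u)))
                                         (prismPosition c (rung u)))
                (zigzag-involutive false u)

      prismPartner-injective : ∀ u {c c′} → prismPartner c u ≡ prismPartner c′ u → c ≡ c′
      prismPartner-injective u {c} {c′} = injective (prismPosition c u) (prismPosition c′ u)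
        where
        x = forwardColour u
        y = backwardColour u
        ⊕d≢⊖d : u ⊕ d ≢ u ⊖ d
        ⊕d≢⊖d = ⊕≢⊖ u (>-nonZero⁻¹ d) d+d<t
        rung-not-d : Length d u (rung u) → ⊥
        rung-not-d = Length-a-d-disjoint (zigzag-Length false u)
        injective : ∀ {c c′} → (p : Position c x y) (p′ : Position c′ x y) → step p u ≡ step p′ u → c ≡ c′
        injective (at-x c≡x)          (at-x c′≡x)           _  = trans c≡x (sym c′≡x)
        injective (at-y _ c≡y)        (at-y _ c′≡y)         _  = trans c≡y (sym c′≡y)
        injective (elsewhere c≢x c≢y) (elsewhere c′≢x c′≢y) _  =
          trans (third-unique x y _ (forward≢backward u) c≢x c≢y)
                (sym (third-unique x y _ (forward≢backward u) c′≢x c′≢y))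
        injective (at-x _)            (at-y _ _)            eq = ⊥-elim (⊕d≢⊖d eq)
        injective (at-y _ _)          (at-x _)              eq = ⊥-elim (⊕d≢⊖d (sym eq))
        injective (at-x _)            (elsewhere _ _)       eq = ⊥-elim (rung-not-d (inj₁ (sym eq)))
        injective (elsewhere _ _)     (at-x _)              eq = ⊥-elim (rung-not-d (inj₁ eq))
        injective (at-y _ _)          (elsewhere _ _)       eq = ⊥-elim (rung-not-d (inj₂ (sym eq)))
        injective (elsewhere _ _)     (at-y _ _)            eq = ⊥-elim (rung-not-d (inj₂ eq))

      prismColourOf : ∀ {u v} → PrismArc u v → Fin 3
      prismColourOf {u} (inj₁ (inj₁ _)) = forwardColour u
      prismColourOf {u} (inj₁ (inj₂ _)) = backwardColour u
      prismColourOf {u} (inj₂ _)        = third (forwardColour u) (backwardColour u)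

      prismPartner-colourOf : ∀ {u v} (e : PrismArc u v) → prismPartner (prismColourOf e) u ≡ v
      prismPartner-colourOf {u} (inj₁ (inj₁ p)) = trans (step-at-x u refl (prismPosition _ u)) (sym p)
      prismPartner-colourOf {u} (inj₁ (inj₂ p)) =
        trans (step-at-y u (forward≢backward u ∘ sym) refl (prismPosition _ u)) (sym p)
      prismPartner-colourOf {u} (inj₂ p) =
        trans (step-elsewhere u third≢x third≢y (prismPosition _ u)) (sym p)
        where
        third≢x = proj₁ (third-avoids _ _ (forward≢backward u))
        third≢y = proj₂ (third-avoids _ _ (forward≢backward u))

      prismFactorization : OneFactorization PrismArc
      prismFactorization = record
        { k                  = 3
        ; partner            = prismPartner
        ; partner-adjacent   = prismPartner-adjacent
        ; partner-involutive = prismPartner-involutive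
        ; colourOf           = prismColourOf
        ; partner-colourOf   = prismPartner-colourOf
        ; partner-injective  = prismPartner-injective
        }

      pairFactorization : OneFactorization (λ u v → Length a u v ⊎ Length d u v)
      pairFactorization = transfer (mk⇔ to from) (union prismFactorization (zigzagFactorization true) disjoint)
        where
        disjoint : ∀ {u v} → PrismArc u v → v ≡ zigzag true u → ⊥
        disjoint {u} (inj₁ ld) p = Length-a-d-disjoint (subst (Length a u) (sym p) (zigzag-Length true u)) ld
        disjoint {u} (inj₂ q)  p = zigzag-distinct u (trans (sym q) p)
        to : ∀ {u v} → PrismArc u v ⊎ v ≡ zigzag true u → Length a u v ⊎ Length d u v
        to         (inj₁ (inj₁ ld)) = inj₂ ld
        to {u}     (inj₁ (inj₂ q))  = inj₁ (subst (Length a u) (sym q) (zigzag-Length false u))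
        to {u}     (inj₂ q)         = inj₁ (subst (Length a u) (sym q) (zigzag-Length true u))
        from : ∀ {u v} → Length a u v ⊎ Length d u v → PrismArc u v ⊎ v ≡ zigzag true u
        from (inj₂ ld) = inj₁ (inj₁ ld)
        from (inj₁ la) with Length-zigzag la
        ... | false , p = inj₁ (inj₂ p)
        ... | true  , p = inj₂ p

module Arcs (t : ℕ) .{{_ : NonZero t}} where

  open Cyclic t

  private
    -[k]%ℕt≡t∸k : ∀ {k} → 0 < k → k < t → (- (+ k)) %ℕ t ≡ t ∸ k
    -[k]%ℕt≡t∸k {suc r} _ k<t with suc r % t | m<n⇒m%n≡m k<t
    ... | .(suc r) | refl = refl

    [w⊖t]%ℕt≡w%t : ∀ {w} → 0 < w → (w ℤ.⊖ t) %ℕ t ≡ w % t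
    [w⊖t]%ℕt≡w%t {w} 0<w with ≤-<-connex t w
    ... | inj₁ t≤w = trans (cong (_%ℕ t) (⊖-≥ t≤w)) (m≤n⇒[n∸m]%m≡n%m t≤w)
    ... | inj₂ w<t = begin
      (w ℤ.⊖ t) %ℕ t        ≡⟨ cong (_%ℕ t) (⊖-< w<t) ⟩
      (- (+ (t ∸ w))) %ℕ t  ≡⟨ -[k]%ℕt≡t∸k (m<n⇒0<n∸m w<t) (∸-monoʳ-< 0<w (<⇒≤ w<t)) ⟩
      t ∸ (t ∸ w)           ≡⟨ m∸[m∸n]≡n (<⇒≤ w<t) ⟩
      w                     ≡⟨ m<n⇒m%n≡m w<t ⟨
      w % t                 ∎
      where open ≡-Reasoning

    [u-j]%ℕt≡u⊖j : ∀ u {j} → 0 < j → j < t → ((+ toℕ u) ℤ.+ - (+ j)) %ℕ t ≡ toℕ (u ⊖ j)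
    [u-j]%ℕt≡u⊖j u {j} 0<j j<t = begin
      ((+ x) ℤ.+ - (+ j)) %ℕ t                  ≡⟨ cong (_%ℕ t) (m-n≡m⊖n x j) ⟩
      (x ℤ.⊖ j) %ℕ t                            ≡⟨ cong (_%ℕ t) (+-cancelˡ-⊖ (t ∸ j) x j) ⟨
      ((t ∸ j + x) ℤ.⊖ (t ∸ j + j)) %ℕ t        ≡⟨ cong₂ (λ a b → (a ℤ.⊖ b) %ℕ t) (+-comm (t ∸ j) x) (m∸n+n≡m (<⇒≤ j<t)) ⟩
      ((x + (t ∸ j)) ℤ.⊖ t) %ℕ t                ≡⟨ [w⊖t]%ℕt≡w%t (≤-trans (m<n⇒0<n∸m j<t) (m≤n+m (t ∸ j) x)) ⟩
      (x + (t ∸ j)) % t                         ≡⟨ toℕ-⊕ u (t ∸ j) ⟨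
      toℕ (u ⊖ j)                               ∎
      where
      open ≡-Reasoning
      x = toℕ u

    toℕ-equation⇔ : ∀ {m : ℕ} {v w : Fin t} → m ≡ toℕ w → (m ≡ toℕ v) ⇔ (v ≡ w)
    toℕ-equation⇔ m≡w = mk⇔ (λ m≡v → toℕ-injective (trans (sym m≡v) m≡w)) (λ v≡w → trans m≡w (cong toℕ (sym v≡w)))

  Hits : Fin t → Fin t → ℤ → Set
  Hits u v z = ((+ toℕ u) ℤ.+ z) %ℕ t ≡ toℕ v

  Arc⇔Any : ∀ {S u v} → Arc t S u v ⇔ Any (Hits u v) S
  Arc⇔Any = mk⇔ (λ a → Any.map toWitness (any⁻ _ _ (Equivalence.from T-≡ a)))
                (λ h → Equivalence.to T-≡ (any⁺ _ (Any.map fromWitness h)))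

  private
    toAny : ∀ {S u v} → Arc t S u v → Any (Hits u v) S
    toAny = Equivalence.to Arc⇔Any

    fromAny : ∀ {S u v} → Any (Hits u v) S → Arc t S u v
    fromAny = Equivalence.from Arc⇔Any

  Arc-++ : ∀ S₁ S₂ {u v} → Arc t (S₁ ++ S₂) u v ⇔ (Arc t S₁ u v ⊎ Arc t S₂ u v)
  Arc-++ S₁ S₂ = mk⇔
    (λ a → Sum.map fromAny fromAny (++⁻ S₁ (toAny {S₁ ++ S₂} a)))
    (λ a → fromAny {S₁ ++ S₂} ([ (λ a₁ → ++⁺ˡ (toAny {S₁} a₁)) , (λ a₂ → ++⁺ʳ S₁ (toAny {S₂} a₂)) ]′ a))

  Arc-singleton : ∀ {j u v} → Arc t (+ j ∷ []) u v ⇔ v ≡ u ⊕ j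
  Arc-singleton {j} {u} = mk⇔ (λ a → Equivalence.to hit⇔ (here⁻¹ (toAny {+ j ∷ []} a)))
                              (λ e → fromAny {+ j ∷ []} (here (Equivalence.from hit⇔ e)))
    where
    hit⇔ : ∀ {v} → Hits u v (+ j) ⇔ v ≡ u ⊕ j
    hit⇔ = toℕ-equation⇔ (sym (toℕ-⊕ u j))
    here⁻¹ : ∀ {P : ℤ → Set} {z} → Any P (z ∷ []) → P z
    here⁻¹ (here p) = p

  Arc-pm : ∀ {m u v} → m < t → Arc t (pm m) u v ⇔ Lengths m u v
  Arc-pm {m} {u} {v} m<t = mk⇔ to from
    where
    signed : ℕ → List ℤ
    signed i = + i ∷ - (+ i) ∷ []

    forwards : ∀ i → Hits u v (+ i) ⇔ v ≡ u ⊕ i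
    forwards i = toℕ-equation⇔ (sym (toℕ-⊕ u i))

    backwards : ∀ {i} → i < m → Hits u v (- (+ suc i)) ⇔ v ≡ u ⊖ suc i
    backwards i<m = toℕ-equation⇔ ([u-j]%ℕt≡u⊖j u (s≤s z≤n) (≤-<-trans i<m m<t))

    to : Arc t (pm m) u v → Lengths m u v
    to a with i , i∈ , hit ← find (map⁻ (concatMap⁻ signed (toAny a))) =
      i , ∈-upTo⁻ i∈ , length hit
      where
      length : Any (Hits u v) (signed (suc i)) → Length (suc i) u v
      length (here h)          = inj₁ (Equivalence.to (forwards (suc i)) h)
      length (there (here h))  = inj₂ (Equivalence.to (backwards (∈-upTo⁻ i∈)) h)

    from : Lengths m u v → Arc t (pm m) u v
    from (i , i<m , l) = fromAny (concatMap⁺ signed (map⁺ (lose (∈-upTo⁺ i<m) (hit l))))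
      where
      hit : Length (suc i) u v → Any (Hits u v) (signed (suc i))
      hit (inj₁ p) = here (Equivalence.from (forwards (suc i)) p)
      hit (inj₂ p) = there (here (Equivalence.from (backwards i<m) p))

half+half≡ : ∀ {t} → 2 ∣ t → t / 2 + t / 2 ≡ t
half+half≡ {t} 2∣t = trans (cong (λ x → t / 2 + x) (sym (+-identityʳ (t / 2)))) (trans (*-comm 2 (t / 2)) (m/n*n≡m 2∣t))

half-<-half : ∀ {s t} → 2 ∣ t → s < t → s / 2 < t / 2
half-<-half {s} 2∣t s<t = m<n*o⇒m/o<n (subst (s <_) (sym (m/n*n≡m 2∣t)) s<t)

module Circulant (t : ℕ) .{{_ : NonZero t}} (t-even : 2 ∣ t) where

  open Cyclic t
  open EvenOrder t-even
  open Arcs t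

  n : ℕ
  n = t / 2

  private
    n+n≡t : n + n ≡ t
    n+n≡t = half+half≡ t-even

    m<t : ∀ {m} → m < n → m < t
    m<t m<n = subst (_ <_) n+n≡t (<-≤-trans m<n (m≤m+n n n))

    sum<t : ∀ {i j} → i < n → j < n → i + j < t
    sum<t i<n j<n = subst (_ <_) n+n≡t (+-mono-< i<n j<n)

  adjacentLengthsFactorization : ∀ i → suc (suc i) < n →
    OneFactorization (λ u v → Length (suc i) u v ⊎ Length (suc (suc i)) u v)
  adjacentLengthsFactorization i i+2<n = byParity (m%2-cases (suc i))
    where
    i+1<n : suc i < n
    i+1<n = <-trans (n<1+n (suc i)) i+2<n
    byParity : suc i % 2 ≡ 0 ⊎ suc i % 2 ≡ 1 →
               OneFactorization (λ u v → Length (suc i) u v ⊎ Length (suc (suc i)) u v)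
    byParity (inj₁ even) = transfer (mk⇔ Sum.swap Sum.swap)
      (Prism.pairFactorization (suc (suc i)) (suc i) (m%2≡0⇒[1+m]%2≡1 {suc i} even) even
        (sum<t i+2<n i+2<n) (sum<t i+1<n i+1<n) (sum<t i+2<n i+1<n))
    byParity (inj₂ odd) = Prism.pairFactorization (suc i) (suc (suc i)) odd (m%2≡1⇒[1+m]%2≡0 {suc i} odd)
        (sum<t i+1<n i+1<n) (sum<t i+2<n i+2<n) (sum<t i+1<n i+2<n)

  lengthsFactorization : ∀ m → m < n → OneFactorization (Lengths m)
  lengthsFactorization zero _ = transfer (mk⇔ ⊥-elim λ { (_ , () , _) }) emptyFactorization
  lengthsFactorization (suc zero) 1<n =
    transfer (mk⇔ (λ l → 0 , s≤s z≤n , l) λ { (zero , _ , l) → l ; (suc _ , s≤s () , _) })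
             (Zigzag.oddLengthFactorization 1 refl (sum<t 1<n 1<n))
  lengthsFactorization (suc (suc m)) m+2<n =
    transfer (mk⇔ to from)
             (union (lengthsFactorization m m<n) (adjacentLengthsFactorization m m+2<n) disjoint)
    where
    m+1<n : suc m < n
    m+1<n = <-trans (n<1+n (suc m)) m+2<n

    m<n : m < n
    m<n = <-trans (n<1+n m) m+1<n

    disjoint : ∀ {u v} → Lengths m u v → Length (suc m) u v ⊎ Length (suc (suc m)) u v → ⊥
    disjoint (i , i<m , l) (inj₁ l′) =
      <-irrefl (suc-injective (Length-unique z<s z<s (sum<t (≤-<-trans i<m m<n) m+1<n) l l′)) i<m
    disjoint (i , i<m , l) (inj₂ l′) =
      <-irrefl (suc-injective (Length-unique z<s z<s (sum<t (≤-<-trans i<m m<n) m+2<n) l l′)) (m<n⇒m<1+n i<m)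

    to : ∀ {u v} → Lengths m u v ⊎ (Length (suc m) u v ⊎ Length (suc (suc m)) u v) → Lengths (suc (suc m)) u v
    to (inj₁ (i , i<m , l)) = i , m<n⇒m<1+n (m<n⇒m<1+n i<m) , l
    to (inj₂ (inj₁ l))      = m , m<n⇒m<1+n (n<1+n m) , l
    to (inj₂ (inj₂ l))      = suc m , n<1+n (suc m) , l

    from : ∀ {u v} → Lengths (suc (suc m)) u v → Lengths m u v ⊎ (Length (suc m) u v ⊎ Length (suc (suc m)) u v)
    from (i , i<m+2 , l) with m<1+n⇒m<n∨m≡n i<m+2
    ... | inj₂ refl = inj₂ (inj₂ l)
    ... | inj₁ i<m+1 with m<1+n⇒m<n∨m≡n i<m+1
    ...   | inj₁ i<m  = inj₁ (i , i<m , l)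
    ...   | inj₂ refl = inj₂ (inj₁ l)

  diameterFactorization : OneFactorization (λ u v → v ≡ u ⊕ n)
  diameterFactorization =
    involutionFactorization (_⊕ n) (λ u → trans (⊕-assoc u n n) (trans (cong (u ⊕_) n+n≡t) (⊕-period u)))

  pmFactorization : ∀ m → m < n → OneFactorization (Arc t (pm m))
  pmFactorization m m<n = transfer (⇔-sym (Arc-pm (m<t m<n))) (lengthsFactorization m m<n)

  pmDiameterFactorization : ∀ m → m < n → OneFactorization (Arc t (pm m ++ + n ∷ []))
  pmDiameterFactorization m m<n =
    transfer (mk⇔ to from) (union (lengthsFactorization m m<n) diameterFactorization disjoint)
    where
    disjoint : ∀ {u v} → Lengths m u v → v ≡ u ⊕ n → ⊥
    disjoint (i , i<m , l) p = <-irrefl (Length-unique z<s 0<n i+1+n<t l (inj₁ p)) i+1<n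
      where
      i+1<n : suc i < n
      i+1<n = ≤-<-trans i<m m<n
      0<n : 0 < n
      0<n = ≤-<-trans z≤n m<n
      i+1+n<t : suc i + n < t
      i+1+n<t = subst (suc i + n <_) n+n≡t (+-monoˡ-< n i+1<n)
    to : ∀ {u v} → Lengths m u v ⊎ v ≡ u ⊕ n → Arc t (pm m ++ + n ∷ []) u v
    to l = Equivalence.from (Arc-++ (pm m) _)
             (Sum.map (Equivalence.from (Arc-pm (m<t m<n))) (Equivalence.from (Arc-singleton {n})) l)
    from : ∀ {u v} → Arc t (pm m ++ + n ∷ []) u v → Lengths m u v ⊎ v ≡ u ⊕ n
    from a = Sum.map (Equivalence.to (Arc-pm (m<t m<n))) (Equivalence.to (Arc-singleton {n}))
               (Equivalence.to (Arc-++ (pm m) _) a)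

lemma7p1 : (s t : ℕ) .{{_ : NonZero t}} → 2 ∣ t → 2 ≤ s → s < t →
    C2Factorization t (connD s t)
lemma7p1 s t 2∣t _ s<t with s % 2
... | zero  = toC2Factorization (pmDiameterFactorization (s / 2 ∸ 1) s/2-1<t/2)
  where
  open Circulant t 2∣t
  s/2-1<t/2 : s / 2 ∸ 1 < t / 2
  s/2-1<t/2 = ≤-<-trans (m∸n≤m (s / 2) 1) (half-<-half 2∣t s<t)
... | suc _ = toC2Factorization (pmFactorization (s / 2) (half-<-half 2∣t s<t))
  where open Circulant t 2∣t
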